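{- Let $A\in\{0,1\}^{m\times n}$ be a matrix with $\operatorname{rank}A=n$, having $\mathbf 1^T$ as one of its rows, and such that for any two rows $a_1^T,a_2^T$ of $A$ their entrywise minimum and entrywise maximum are also rows of $A$. Then: (i) there is a row $a^T$ of $A$ with $\mathbf 1^Ta=n-1$; (ii) for every row $a^T$ of $A$ with $\mathbf 1^Ta>1$ there is a row $\tilde a^T$ of $A$ with $\mathbf 1^T\tilde a=\mathbf 1^Ta-1$ and $\tilde a\leq a$ entrywise; (iii) there exist rows $a_1^T,\ldots,a_{n-1}^T$ of $A$ and a permutation $\sigma\in S_n$ such that $a_j=\sum_{i=1}^j e_{\sigma(i)}$ for $j=1,\ldots,n-1$ (i.e. the matrix with rows $a_1^T,\ldots,a_{n-1}^T,\mathbf 1^T$ equals $L\,\underline{\sigma}$, where $L$ is the lower triangular matrix of ones and $\underline\sigma$ the permutation matrix with $(\underline\sigma x)_j=x_{\sigma(j)}$).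
   Context: $\mathbf 1=(1,\ldots,1)^T$, $e_i$ standard basis vectors, $S_n$ the symmetric group. -}

module Defs where

open import Data.Nat using (ℕ; zero; suc; _+_; _≤?_)
open import Data.Fin using (Fin; toℕ) renaming (zero to fz; suc to fs)
open import Data.Bool using (Bool; true; false; if_then_else_)
open import Data.Rational using (ℚ; 0ℚ) renaming (_+_ to _+ℚ_)
open import Data.Fin.Permutation using (Permutation′; _⟨$⟩ˡ_)
open import Relation.Nullary.Decidable using (⌊_⌋)
open import Relation.Binary.PropositionalEquality using (_≡_)

Matrix01 : ℕ → ℕ → Set
Matrix01 m n = Fin m → Fin n → Bool

ones : ∀ {n} → (Fin n → Bool) → ℕ
ones {zero} a = 0
ones {suc n} a = (if a fz then 1 else 0) + ones (λ k → a (fs k))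

dotℚ : ∀ {n} → (Fin n → Bool) → (Fin n → ℚ) → ℚ
dotℚ {zero} a x = 0ℚ
dotℚ {suc n} a x = (if a fz then x fz else 0ℚ) +ℚ dotℚ (λ k → a (fs k)) (λ k → x (fs k))

FullColumnRank : ∀ {m n} → Matrix01 m n → Set
FullColumnRank {m} {n} A = (x : Fin n → ℚ) → (∀ i → dotℚ (A i) x ≡ 0ℚ) → ∀ k → x k ≡ 0ℚ

-- the 0/1 vector Σ_{i=1}^{j+1} e_{σ(i)} (0-indexed: entries σ(0),…,σ(j) are 1),
-- i.e. entry k is 1 iff σ⁻¹(k) ≤ j
prefixRow : ∀ {n} → Permutation′ n → ℕ → Fin n → Bool
prefixRow σ j k = ⌊ toℕ (σ ⟨$⟩ˡ k) ≤? j ⌋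

module Submission where

-- Rows of A are read as subsets of the column set.  Full column rank is used
-- once: applied to e_j − e_k it shows that any two distinct columns are
-- separated by a row.  Separation and lattice closure give (ii): inside a
-- row a with |a| ≥ 2 start from a row c ⊆ a missing a column of a; while
-- a ∖ c has two columns u, w, replace c by c ∨ (s ∧ a) for a row s with
-- u ∈ s ∌ w, which stays inside a, keeps w out and shrinks a ∖ c.  Part (i)
-- is (ii) for the row 𝟏.  For (iii), iterating (ii) from 𝟏 gives a chain
-- 𝟏 = r₀ ⊋ … ⊋ r_{n−1} of sizes n, …, 1; if T k is the last step still
-- containing column k, then k ↦ n − 1 − T k is injective (each step drops
-- one column), hence a permutation, whose prefix rows are the r_{n−1−j}.

open import Defs
open import Data.Nat using (ℕ; zero; suc; _+_; _≤_; _<_; _∸_; z≤n; s≤s; _≤?_; _<?_)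
open import Data.Nat.Properties
  using (≤-refl; ≤-trans; ≤-antisym; ≤-pred; <-irrefl; ≰⇒>; m≤n+m; m<m+n;
         +-comm; +-suc; +-identityʳ; +-cancelˡ-≡; +-cancelʳ-≡; +-monoʳ-≤; suc-injective;
         m≤n⇒m<n∨m≡n; m∸n≤m; m≤n+m∸n; m≤n+o⇒m∸n≤o; ∸-cancelˡ-≡; module ≤-Reasoning)
open import Data.Fin using (Fin; toℕ; fromℕ<; punchOut) renaming (zero to fz; suc to fs)
open import Data.Fin.Properties using (any?; toℕ-fromℕ<; punchOut-injective; injective⇒≤)
  renaming (_≟_ to _≟ᶠ_; suc-injective to fsuc-injective)
open import Data.Fin.Permutation using (Permutation′; permutation; _⟨$⟩ˡ_)
import Data.Fin.Permutation as Permutation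
open import Data.Bool using (Bool; true; false; _∧_; _∨_; not; if_then_else_)
  renaming (_≟_ to _≟ᵇ_)
open import Data.Bool.Properties using (∧-conicalʳ; ∧-zeroʳ; ∨-zeroʳ; ¬-not)
open import Data.Rational using (ℚ; 0ℚ; 1ℚ; -_) renaming (_+_ to _+ℚ_)
open import Data.Rational.Properties using (+-0-commutativeMonoid)
  renaming (+-identityˡ to +ℚ-identityˡ; +-identityʳ to +ℚ-identityʳ)
open import Algebra.Bundles using (CommutativeMonoid)
open import Algebra.Properties.CommutativeSemigroup
  (CommutativeMonoid.commutativeSemigroup +-0-commutativeMonoid) using (interchange)
open import Data.Product using (Σ; ∃; _×_; _,_; proj₁; proj₂)
open import Data.Sum using (_⊎_; inj₁; inj₂)
open import Function.Definitions using (Injective)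
open import Relation.Nullary using (yes; no; ¬?; contradiction)
open import Relation.Nullary.Decidable using (Dec; ⌊_⌋; decidable-stable)
open import Relation.Binary.PropositionalEquality
  using (_≡_; _≢_; refl; sym; trans; cong; cong₂; subst; module ≡-Reasoning)

_⊆_ : ∀ {n} → (Fin n → Bool) → (Fin n → Bool) → Set
u ⊆ v = ∀ k → u k ≡ true → v k ≡ true

_∖_ : ∀ {n} → (Fin n → Bool) → (Fin n → Bool) → Fin n → Bool
(u ∖ v) k = u k ∧ not (v k)

∨-true : ∀ x y → x ∨ y ≡ true → x ≡ true ⊎ y ≡ true
∨-true true  _ _ = inj₁ refl
∨-true false _ p = inj₂ p

∧-not-true : ∀ x y → x ∧ not y ≡ true → x ≡ true × y ≡ false
∧-not-true true false _ = refl , refl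

∖-intro : ∀ {n} {u v : Fin n → Bool} {k} → u k ≡ true → v k ≡ false → (u ∖ v) k ≡ true
∖-intro uk vk rewrite uk | vk = refl

∖-out : ∀ {n} (u : Fin n → Bool) {v : Fin n → Bool} {k} → v k ≡ true → (u ∖ v) k ≡ false
∖-out u {k = k} vk rewrite vk = ∧-zeroʳ (u k)

∖-antitone : ∀ {n} {u v v′ : Fin n → Bool} → v ⊆ v′ → (u ∖ v′) ⊆ (u ∖ v)
∖-antitone {u = u} {v} {v′} v⊆v′ k h with ∧-not-true (u k) (v′ k) h
... | uk , v′k = ∖-intro {u = u} {v} uk (¬-not (λ vk → contradiction (trans (sym (v⊆v′ k vk)) v′k) λ ()))

ones-cong : ∀ {n} {u v : Fin n → Bool} → (∀ k → u k ≡ v k) → ones u ≡ ones v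
ones-cong {zero}  e = refl
ones-cong {suc n} e = cong₂ _+_ (cong (λ b → if b then 1 else 0) (e fz)) (ones-cong (λ k → e (fs k)))

ones-full : ∀ n → ones {n} (λ _ → true) ≡ n
ones-full zero    = refl
ones-full (suc n) = cong suc (ones-full n)

ones-∖ : ∀ {n} {a c : Fin n → Bool} → c ⊆ a → ones a ≡ ones c + ones (a ∖ c)
ones-∖ {zero} _ = refl
ones-∖ {suc n} {a} {c} c⊆a
  with c fz in c0 | a fz in a0 | ones-∖ {a = λ k → a (fs k)} {λ k → c (fs k)} (λ k → c⊆a (fs k))
... | true  | true  | rest = cong suc rest
... | true  | false | _    = contradiction (trans (sym (c⊆a fz c0)) a0) λ ()
... | false | true  | rest = trans (cong suc rest) (sym (+-suc _ _))
... | false | false | rest = rest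

ones-member : ∀ {n} (v : Fin n → Bool) k → v k ≡ true → 1 ≤ ones v
ones-member v fz     vk rewrite vk = s≤s z≤n
ones-member v (fs k) vk = ≤-trans (ones-member (λ k → v (fs k)) k vk) (m≤n+m _ _)

ones-positive : ∀ {n} (v : Fin n → Bool) → 1 ≤ ones v → ∃ λ k → v k ≡ true
ones-positive {suc n} v pos with v fz in v0
... | true  = fz , v0
... | false with ones-positive (λ k → v (fs k)) pos
...   | k , vk = fs k , vk

ones-two : ∀ {n} (v : Fin n → Bool) → 2 ≤ ones v → ∃ λ j → ∃ λ k → j ≢ k × v j ≡ true × v k ≡ true
ones-two {suc n} v two with v fz in v0
... | true with ones-positive (λ k → v (fs k)) (≤-pred two)
...   | k , vk = fz , fs k , (λ ()) , v0 , vk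
ones-two {suc n} v two | false with ones-two (λ k → v (fs k)) two
...   | j , k , j≢k , vj , vk = fs j , fs k , (λ e → j≢k (fsuc-injective e)) , vj , vk

two-members : ∀ {n} (v : Fin n → Bool) j k → j ≢ k → v j ≡ true → v k ≡ true → 2 ≤ ones v
two-members v fz     fz     j≢k _  _  = contradiction refl j≢k
two-members v fz     (fs k) _   vj vk rewrite vj = s≤s (ones-member (λ k → v (fs k)) k vk)
two-members v (fs j) fz     _   vj vk rewrite vk = s≤s (ones-member (λ k → v (fs k)) j vj)
two-members v (fs j) (fs k) j≢k vj vk =
  ≤-trans (two-members (λ k → v (fs k)) j k (λ e → j≢k (cong fs e)) vj vk) (m≤n+m _ _)

ones≡1-unique : ∀ {n} (v : Fin n → Bool) → ones v ≡ 1 → ∀ {j k} → v j ≡ true → v k ≡ true → j ≡ k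
ones≡1-unique v one {j} {k} vj vk with j ≟ᶠ k
... | yes j≡k = j≡k
... | no  j≢k = contradiction (subst (2 ≤_) one (two-members v j k j≢k vj vk)) λ { (s≤s ()) }

ones-⊂ : ∀ {n} {u v : Fin n → Bool} → u ⊆ v → ∀ {p} → v p ≡ true → u p ≡ false → ones u < ones v
ones-⊂ {u = u} {v} u⊆v {p} vp up = begin-strict
  ones u                 <⟨ m<m+n (ones u) (ones-member (v ∖ u) p (∖-intro {u = v} {u} vp up)) ⟩
  ones u + ones (v ∖ u)  ≡⟨ sym (ones-∖ u⊆v) ⟩
  ones v                 ∎
  where open ≤-Reasoning

gap1⇒cover : ∀ {n} {u v : Fin n → Bool} → u ⊆ v → ones (v ∖ u) ≡ 1 → suc (ones u) ≡ ones v
gap1⇒cover {u = u} {v} u⊆v one = begin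
  suc (ones u)           ≡⟨ +-comm 1 (ones u) ⟩
  ones u + 1             ≡⟨ cong (ones u +_) (sym one) ⟩
  ones u + ones (v ∖ u)  ≡⟨ sym (ones-∖ u⊆v) ⟩
  ones v                 ∎
  where open ≡-Reasoning

cover⇒gap1 : ∀ {n} {u v : Fin n → Bool} → u ⊆ v → suc (ones u) ≡ ones v → ones (v ∖ u) ≡ 1
cover⇒gap1 {u = u} {v} u⊆v cover =
  +-cancelˡ-≡ (ones u) (ones (v ∖ u)) 1 (trans (sym (ones-∖ u⊆v)) (trans (sym cover) (+-comm 1 (ones u))))

-- Full column rank separates columns

unit : ∀ {n} → Fin n → ℚ → Fin n → ℚ
unit fz     q fz     = q
unit fz     q (fs l) = 0ℚ
unit (fs j) q fz     = 0ℚ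
unit (fs j) q (fs l) = unit j q l

unit-at : ∀ {n} (j : Fin n) q → unit j q j ≡ q
unit-at fz     q = refl
unit-at (fs j) q = unit-at j q

unit-off : ∀ {n} (j l : Fin n) q → j ≢ l → unit j q l ≡ 0ℚ
unit-off fz     fz     q j≢l = contradiction refl j≢l
unit-off fz     (fs l) q _   = refl
unit-off (fs j) fz     q _   = refl
unit-off (fs j) (fs l) q j≢l = unit-off j l q (λ e → j≢l (cong fs e))

dot-+ : ∀ {n} (a : Fin n → Bool) (x y : Fin n → ℚ) → dotℚ a (λ l → x l +ℚ y l) ≡ dotℚ a x +ℚ dotℚ a y
dot-+ {zero}  a x y = refl
dot-+ {suc n} a x y = trans
  (cong₂ _+ℚ_ (if-+ (a fz)) (dot-+ (λ k → a (fs k)) (λ k → x (fs k)) (λ k → y (fs k))))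
  (interchange (if a fz then x fz else 0ℚ) (if a fz then y fz else 0ℚ)
               (dotℚ (λ k → a (fs k)) (λ k → x (fs k))) (dotℚ (λ k → a (fs k)) (λ k → y (fs k))))
  where
  if-+ : ∀ b → (if b then x fz +ℚ y fz else 0ℚ) ≡ (if b then x fz else 0ℚ) +ℚ (if b then y fz else 0ℚ)
  if-+ true  = refl
  if-+ false = refl

if-0 : ∀ b → (if b then 0ℚ else 0ℚ) ≡ 0ℚ
if-0 true  = refl
if-0 false = refl

dot-0 : ∀ {n} (a : Fin n → Bool) → dotℚ a (λ _ → 0ℚ) ≡ 0ℚ
dot-0 {zero}  a = refl
dot-0 {suc n} a = cong₂ _+ℚ_ (if-0 (a fz)) (dot-0 (λ k → a (fs k)))

dot-unit : ∀ {n} (a : Fin n → Bool) j q → dotℚ a (unit j q) ≡ (if a j then q else 0ℚ)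
dot-unit {suc n} a fz q = trans (cong ((if a fz then q else 0ℚ) +ℚ_) (dot-0 (λ k → a (fs k)))) (+ℚ-identityʳ _)
dot-unit {suc n} a (fs j) q =
  trans (cong₂ _+ℚ_ (if-0 (a fz)) (dot-unit (λ k → a (fs k)) j q)) (+ℚ-identityˡ _)

Separating : ∀ {m n} → Matrix01 m n → Set
Separating {n = n} A = ∀ (j k : Fin n) → j ≢ k → ∃ λ i → A i j ≢ A i k

-- If no row separates columns j ≠ k then A (e_j − e_k) = 0 with e_j − e_k ≠ 0.
fullRank⇒separating : ∀ {m n} (A : Matrix01 m n) → FullColumnRank A → Separating A
fullRank⇒separating A rank j k j≢k with any? (λ i → ¬? (A i j ≟ᵇ A i k))
... | yes separated = separated
... | no  none      = contradiction (trans (sym x-at-j) (rank x annihilated j)) λ ()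
  where
  x : _ → ℚ
  x l = unit j 1ℚ l +ℚ unit k (- 1ℚ) l

  agree : ∀ i → A i j ≡ A i k
  agree i = decidable-stable (A i j ≟ᵇ A i k) (λ differ → none (i , differ))

  cancel : ∀ b → (if b then 1ℚ else 0ℚ) +ℚ (if b then - 1ℚ else 0ℚ) ≡ 0ℚ
  cancel true  = refl
  cancel false = refl

  annihilated : ∀ i → dotℚ (A i) x ≡ 0ℚ
  annihilated i = begin
    dotℚ (A i) x
      ≡⟨ dot-+ (A i) (unit j 1ℚ) (unit k (- 1ℚ)) ⟩
    dotℚ (A i) (unit j 1ℚ) +ℚ dotℚ (A i) (unit k (- 1ℚ))
      ≡⟨ cong₂ _+ℚ_ (dot-unit (A i) j 1ℚ) (dot-unit (A i) k (- 1ℚ)) ⟩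
    (if A i j then 1ℚ else 0ℚ) +ℚ (if A i k then - 1ℚ else 0ℚ)
      ≡⟨ cong (λ b → (if b then 1ℚ else 0ℚ) +ℚ (if A i k then - 1ℚ else 0ℚ)) (agree i) ⟩
    (if A i k then 1ℚ else 0ℚ) +ℚ (if A i k then - 1ℚ else 0ℚ)
      ≡⟨ cancel (A i k) ⟩
    0ℚ ∎
    where open ≡-Reasoning

  x-at-j : x j ≡ 1ℚ
  x-at-j = cong₂ _+ℚ_ (unit-at j 1ℚ) (unit-off k j (- 1ℚ) (λ e → j≢k (sym e)))

-- Lower covers in a lattice of rows: part (ii)

MeetClosed : ∀ {m n} → Matrix01 m n → Set
MeetClosed A = ∀ i₁ i₂ → ∃ λ l → ∀ k → A l k ≡ (A i₁ k ∧ A i₂ k)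

JoinClosed : ∀ {m n} → Matrix01 m n → Set
JoinClosed A = ∀ i₁ i₂ → ∃ λ l → ∀ k → A l k ≡ (A i₁ k ∨ A i₂ k)

LowerCover : ∀ {m n} → Matrix01 m n → Fin m → Set
LowerCover A i = ∃ λ l → suc (ones (A l)) ≡ ones (A i) × A l ⊆ A i

module LowerCovers {m n} (A : Matrix01 m n) (separating : Separating A)
                   (meet : MeetClosed A) (join : JoinClosed A) where

  split : (P : Fin n → Bool) → 2 ≤ ones P →
          ∃ λ s → ∃ λ u → ∃ λ w → P u ≡ true × P w ≡ true × A s u ≡ true × A s w ≡ false
  split P two with ones-two P two
  ... | j , k , j≢k , Pj , Pk with separating j k j≢k
  ... | s , differ with A s j in sj | A s k in sk
  ...   | true  | false = s , j , k , Pj , Pk , sj , sk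
  ...   | false | true  = s , k , j , Pk , Pj , sk , sj
  ...   | true  | true  = contradiction refl differ
  ...   | false | false = contradiction refl differ

  meet-below : ∀ s a → ∃ λ c → A c ⊆ A a × (∀ k → A c k ≡ (A s k ∧ A a k))
  meet-below s a with meet s a
  ... | c , c≡ = c , (λ k h → ∧-conicalʳ (A s k) (A a k) (trans (sym (c≡ k)) h)) , c≡

  enlarge : ∀ {a c s u w} → A c ⊆ A a → A a u ≡ true → A c w ≡ false → A s u ≡ true → A s w ≡ false →
            ∃ λ c′ → A c′ ⊆ A a × A c ⊆ A c′ × A c′ u ≡ true × A c′ w ≡ false
  enlarge {a} {c} {s} {u} {w} c⊆a au cw su sw with meet-below s a
  ... | d , d⊆a , d≡ with join c d
  ... | c′ , c′≡ = c′ , c′⊆a , c⊆c′ , c′u , c′w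
    where
    c′⊆a : A c′ ⊆ A a
    c′⊆a k h with ∨-true (A c k) (A d k) (trans (sym (c′≡ k)) h)
    ... | inj₁ ck = c⊆a k ck
    ... | inj₂ dk = d⊆a k dk

    c⊆c′ : A c ⊆ A c′
    c⊆c′ k ck = trans (c′≡ k) (cong (_∨ A d k) ck)

    c′u : A c′ u ≡ true
    c′u = trans (c′≡ u) (trans (cong (A c u ∨_) (trans (d≡ u) (cong₂ _∧_ su au))) (∨-zeroʳ (A c u)))

    c′w : A c′ w ≡ false
    c′w = trans (c′≡ w) (cong₂ _∨_ cw (trans (d≡ w) (cong (_∧ A a w) sw)))

  -- A row c ⊆ a missing a column w of a grows inside a until a ∖ c is a
  -- single column; the fuel bounds |a ∖ c|, which drops at every step.
  grow : ∀ fuel {a c w} → A c ⊆ A a → (A a ∖ A c) w ≡ true → ones (A a ∖ A c) ≤ fuel → LowerCover A a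
  grow zero {a} {c} {w} _ gap bound = contradiction (≤-trans (ones-member (A a ∖ A c) w gap) bound) λ ()
  grow (suc fuel) {a} {c} {w} c⊆a gap bound with 2 ≤? ones (A a ∖ A c)
  ... | no ¬two = c , gap1⇒cover c⊆a single , c⊆a
    where single = ≤-antisym (≤-pred (≰⇒> ¬two)) (ones-member (A a ∖ A c) w gap)
  ... | yes two with split (A a ∖ A c) two
  ... | s , u , w′ , du , dw′ , su , sw′
        with ∧-not-true (A a u) (A c u) du | ∧-not-true (A a w′) (A c w′) dw′
  ... | au , _ | aw′ , cw′ with enlarge c⊆a au cw′ su sw′
  ... | c′ , c′⊆a , c⊆c′ , c′u , c′w′ =
        grow fuel c′⊆a (∖-intro {u = A a} {A c′} aw′ c′w′) (≤-pred (≤-trans shrinks bound))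
    where
    shrinks : ones (A a ∖ A c′) < ones (A a ∖ A c)
    shrinks = ones-⊂ (∖-antitone {u = A a} c⊆c′) du (∖-out (A a) {A c′} c′u)

  lowerCover : ∀ a → 1 < ones (A a) → LowerCover A a
  lowerCover a big with split (A a) big
  ... | s , _ , w , _ , aw , _ , sw with meet-below s a
  ... | c , c⊆a , c≡ =
        grow (ones (A a ∖ A c)) c⊆a (∖-intro {u = A a} {A c} aw (trans (c≡ w) (cong (_∧ A a w) sw))) ≤-refl

Antitone : (ℕ → Bool) → Set
Antitone b = ∀ t → b (suc t) ≡ true → b t ≡ true

antitone-≤ : ∀ {b} → Antitone b → ∀ {s t} → s ≤ t → b t ≡ true → b s ≡ true
antitone-≤ anti {t = t} s≤t bt with m≤n⇒m<n∨m≡n s≤t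
... | inj₂ refl = bt
antitone-≤ anti {t = suc t} _ bt | inj₁ (s≤s s≤t) = antitone-≤ anti s≤t (anti t bt)

-- The largest t ≤ u with b t = true (or 0 when there is none).
lastTrue : (ℕ → Bool) → ℕ → ℕ
lastTrue b zero    = zero
lastTrue b (suc u) = if b (suc u) then suc u else lastTrue b u

lastTrue-≤ : ∀ b u → lastTrue b u ≤ u
lastTrue-≤ b zero = z≤n
lastTrue-≤ b (suc u) with b (suc u)
... | true  = ≤-refl
... | false = ≤-trans (lastTrue-≤ b u) (m≤n+m u 1)

lastTrue-sound : ∀ {b} → b 0 ≡ true → Antitone b → ∀ u {t} → t ≤ lastTrue b u → b t ≡ true
lastTrue-sound b0 anti zero z≤n = b0
lastTrue-sound {b} b0 anti (suc u) t≤last with b (suc u) in bu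
... | true  = antitone-≤ anti t≤last bu
... | false = lastTrue-sound b0 anti u t≤last

lastTrue-complete : ∀ {b} u {t} → t ≤ u → b t ≡ true → t ≤ lastTrue b u
lastTrue-complete zero t≤u _ = t≤u
lastTrue-complete {b} (suc u) t≤u bt with b (suc u) in bu
... | true  = t≤u
... | false with m≤n⇒m<n∨m≡n t≤u
...   | inj₁ (s≤s t≤u′) = lastTrue-complete u t≤u′ bt
...   | inj₂ refl       = contradiction (trans (sym bt) bu) λ ()

-- An injective endomap of Fin n is onto (pigeonhole).
injective⇒surjective : ∀ {n} (f : Fin n → Fin n) → Injective _≡_ _≡_ f → ∀ y → ∃ λ x → f x ≡ y
injective⇒surjective {suc n} f f-inj y with any? (λ x → f x ≟ᶠ y)
... | yes hit  = hit
... | no  miss = contradiction (injective⇒≤ squeezed-inj) (<-irrefl refl)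
  where
  avoids : ∀ x → y ≢ f x
  avoids x e = miss (x , sym e)

  squeezed : Fin (suc n) → Fin n
  squeezed x = punchOut (avoids x)

  squeezed-inj : Injective _≡_ _≡_ squeezed
  squeezed-inj {x} {x′} e = f-inj (punchOut-injective (avoids x) (avoids x′) e)

injection⇒permutation : ∀ {n} (f : Fin n → Fin n) → Injective _≡_ _≡_ f →
                        Σ (Permutation′ n) λ σ → ∀ k → σ ⟨$⟩ˡ k ≡ f k
injection⇒permutation f f-inj = permutation g f g∘f f∘g , λ _ → refl
  where
  g : _ → _
  g y = proj₁ (injective⇒surjective f f-inj y)

  f∘g : ∀ y → f (g y) ≡ y
  f∘g y = proj₂ (injective⇒surjective f f-inj y)

  g∘f : ∀ x → g (f x) ≡ x
  g∘f x = f-inj (f∘g (f x))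

-- A maximal chain of rows: part (iii)

∸-swap : ∀ N a b → N ∸ a ≤ b → N ∸ b ≤ a
∸-swap N a b le = m≤n+o⇒m∸n≤o N b (begin
  N            ≤⟨ m≤n+m∸n N a ⟩
  a + (N ∸ a)  ≤⟨ +-monoʳ-≤ a le ⟩
  a + b        ≡⟨ +-comm a b ⟩
  b + a        ∎)
  where open ≤-Reasoning

size-≥2 : ∀ x t {N} → x + t ≡ suc N → t < N → 1 < x
size-≥2 x zero    {suc N} e _        = subst (1 <_) (trans (sym e) (+-identityʳ x)) (s≤s (s≤s z≤n))
size-≥2 x (suc t) {suc N} e (s≤s lt) = size-≥2 x t (suc-injective (trans (sym (+-suc x t)) e)) lt

≡-⌊⌋ : ∀ {P : Set} {b} → (b ≡ true → P) → (P → b ≡ true) → (d : Dec P) → b ≡ ⌊ d ⌋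
≡-⌊⌋ {b = true}  _ _   (yes _) = refl
≡-⌊⌋ {b = true}  b⇒P _ (no ¬p) = contradiction (b⇒P refl) ¬p
≡-⌊⌋ {b = false} _ P⇒b (yes p) = P⇒b p
≡-⌊⌋ {b = false} _ _   (no _)  = refl

module Chain {m N} (A : Matrix01 m (suc N)) (top : Fin m) (full : ∀ k → A top k ≡ true)
             (cover : ∀ i → 1 < ones (A i) → LowerCover A i) where

  down : Fin m → Fin m
  down i with 1 <? ones (A i)
  ... | yes big = proj₁ (cover i big)
  ... | no  _   = i

  down-⊆ : ∀ i → A (down i) ⊆ A i
  down-⊆ i with 1 <? ones (A i)
  ... | yes big = proj₂ (proj₂ (cover i big))
  ... | no  _   = λ _ h → h

  down-size : ∀ i → 1 < ones (A i) → suc (ones (A (down i))) ≡ ones (A i)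
  down-size i big with 1 <? ones (A i)
  ... | yes big′ = proj₁ (proj₂ (cover i big′))
  ... | no  small = contradiction big small

  r : ℕ → Fin m
  r zero    = top
  r (suc t) = down (r t)

  r-size : ∀ t → t ≤ N → ones (A (r t)) + t ≡ suc N
  r-size zero    _ = trans (+-identityʳ _) (trans (ones-cong full) (ones-full (suc N)))
  r-size (suc t) t<N = begin
    ones (A (r (suc t))) + suc t   ≡⟨ +-suc _ t ⟩
    suc (ones (A (r (suc t)))) + t ≡⟨ cong (_+ t) (down-size (r t) (size-≥2 _ t previous t<N)) ⟩
    ones (A (r t)) + t             ≡⟨ previous ⟩
    suc N                          ∎
    where
    open ≡-Reasoning
    previous = r-size t (≤-trans (m≤n+m t 1) t<N)

  layer : ℕ → Fin (suc N) → Bool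
  layer t = A (r t) ∖ A (r (suc t))

  layer-single : ∀ {t} → t < N → ones (layer t) ≡ 1
  layer-single {t} t<N =
    cover⇒gap1 (down-⊆ (r t)) (down-size (r t) (size-≥2 _ t (r-size t (≤-trans (m≤n+m t 1) t<N)) t<N))

  last-single : ones (A (r N)) ≡ 1
  last-single = +-cancelʳ-≡ N (ones (A (r N))) 1 (r-size N ≤-refl)

  T : Fin (suc N) → ℕ
  T k = lastTrue (λ t → A (r t) k) N

  T-≤ : ∀ k → T k ≤ N
  T-≤ k = lastTrue-≤ (λ t → A (r t) k) N

  member-sound : ∀ k {t} → t ≤ T k → A (r t) k ≡ true
  member-sound k = lastTrue-sound (full k) (λ t → down-⊆ (r t) k) N

  member-complete : ∀ k {t} → t ≤ N → A (r t) k ≡ true → t ≤ T k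
  member-complete k = lastTrue-complete N

  present-at : ∀ {k t} → T k ≡ t → A (r t) k ≡ true
  present-at {k} refl = member-sound k ≤-refl

  leaves-at : ∀ {k t} → T k ≡ t → t < N → layer t k ≡ true
  leaves-at {k} {t} Tk≡t t<N = ∖-intro {u = A (r t)} {A (r (suc t))} (present-at Tk≡t) (¬-not gone)
    where
    gone : A (r (suc t)) k ≢ true
    gone still = <-irrefl refl (subst (suc t ≤_) Tk≡t (member-complete k t<N still))

  T-injective : Injective _≡_ _≡_ T
  T-injective {k} {k′} e with m≤n⇒m<n∨m≡n (T-≤ k)
  ... | inj₁ T<N = ones≡1-unique (layer (T k)) (layer-single T<N) (leaves-at refl T<N) (leaves-at (sym e) T<N)
  ... | inj₂ T≡N = ones≡1-unique (A (r N)) last-single (present-at T≡N) (present-at (trans (sym e) T≡N))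

  -- The position of column k in the permutation.
  ρ : Fin (suc N) → Fin (suc N)
  ρ k = fromℕ< (s≤s (m∸n≤m N (T k)))

  toℕ-ρ : ∀ k → toℕ (ρ k) ≡ N ∸ T k
  toℕ-ρ k = toℕ-fromℕ< (s≤s (m∸n≤m N (T k)))

  ρ-injective : Injective _≡_ _≡_ ρ
  ρ-injective {k} {k′} e =
    T-injective (∸-cancelˡ-≡ (T-≤ k) (T-≤ k′) (trans (sym (toℕ-ρ k)) (trans (cong toℕ e) (toℕ-ρ k′))))

  prefix-member : ∀ j k → A (r (N ∸ j)) k ≡ ⌊ N ∸ T k ≤? j ⌋
  prefix-member j k = ≡-⌊⌋ (λ h → ∸-swap N j (T k) (member-complete k (m∸n≤m N j) h))
                            (λ le → member-sound k (∸-swap N (T k) j le))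
                            (N ∸ T k ≤? j)

  prefixChain : Σ (Permutation′ (suc N)) λ σ → Σ (Fin N → Fin m) λ row →
                ∀ j k → A (row j) k ≡ prefixRow σ (toℕ j) k
  prefixChain with injection⇒permutation ρ ρ-injective
  ... | σ , σ⁻¹≡ρ = σ , (λ j → r (N ∸ toℕ j)) , λ j k → begin
    A (r (N ∸ toℕ j)) k             ≡⟨ prefix-member (toℕ j) k ⟩
    ⌊ N ∸ T k ≤? toℕ j ⌋            ≡⟨ cong (λ p → ⌊ p ≤? toℕ j ⌋) (sym (toℕ-ρ k)) ⟩
    ⌊ toℕ (ρ k) ≤? toℕ j ⌋          ≡⟨ cong (λ p → ⌊ toℕ p ≤? toℕ j ⌋) (sym (σ⁻¹≡ρ k)) ⟩
    prefixRow σ (toℕ j) k           ∎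
    where open ≡-Reasoning

prefixChain : ∀ {m n} (A : Matrix01 m n) (top : Fin m) → (∀ k → A top k ≡ true) →
              (∀ i → 1 < ones (A i) → LowerCover A i) →
              Σ (Permutation′ n) λ σ → Σ (Fin (n ∸ 1) → Fin m) λ row →
              ∀ j k → A (row j) k ≡ prefixRow σ (toℕ j) k
prefixChain {n = zero}  A top full cover = Permutation.id , (λ ()) , λ ()
prefixChain {n = suc N} A top full cover = Chain.prefixChain A top full cover

lemma5p2 : (m n : ℕ) (A : Matrix01 m n)
    → FullColumnRank A
    → (∃ λ i → ∀ k → A i k ≡ true)
    → (∀ i₁ i₂ → ∃ λ l → ∀ k → A l k ≡ (A i₁ k ∧ A i₂ k))
    → (∀ i₁ i₂ → ∃ λ l → ∀ k → A l k ≡ (A i₁ k ∨ A i₂ k))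
    → ((2 ≤ n → ∃ λ i → ones (A i) ≡ n ∸ 1)
      × (∀ i → 1 < ones (A i) → ∃ λ l → suc (ones (A l)) ≡ ones (A i) × (∀ k → A l k ≡ true → A i k ≡ true))
      × (Σ (Permutation′ n) λ σ → Σ (Fin (n ∸ 1) → Fin m) λ r → ∀ j k → A (r j) k ≡ prefixRow σ (toℕ j) k))
lemma5p2 m n A rank (top , full) meet join = coatom , lowerCover , prefixChain A top full lowerCover
  where
  open LowerCovers A (fullRank⇒separating A rank) meet join using (lowerCover)

  top-size : ones (A top) ≡ n
  top-size = trans (ones-cong full) (ones-full n)

  coatom : 2 ≤ n → ∃ λ i → ones (A i) ≡ n ∸ 1
  coatom two with lowerCover top (subst (2 ≤_) (sym top-size) two)
  ... | l , l-size , _ = l , cong (_∸ 1) (trans l-size top-size)
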